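{- Let $\mathcal{F}$ be a finite linear $3$-uniform family with $\Delta(\mathcal{F})=d$ and $\nu(\mathcal{F})=\nu$. Then $|\mathcal{F}|\leq \max\{2d\nu,\,10\nu\}$.
   Context: A family $\mathcal{F}$ is a collection of distinct subsets of a vertex set; it is $3$-uniform if every member has exactly $3$ elements, and linear if $|A\cap B|\leq 1$ for all distinct $A,B\in\mathcal{F}$. A matching is a collection of pairwise disjoint members of $\mathcal{F}$; $\nu(\mathcal{F})$ is the maximum size of a matching. For a vertex $x$, $\mathcal{F}_x=\{A\in\mathcal{F}: x\in A\}$ and $\Delta(\mathcal{F})=\max_x|\mathcal{F}_x|$. -}

module Defs where

open import Data.Nat using (ℕ; _≤_; _⊔_; _*_)
open import Data.Fin using (Fin)
open import Data.Fin.Subset using (Subset; _∩_; ∣_∣; _∈_; Empty)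
open import Data.Fin.Subset.Properties using (_∈?_)
open import Data.List using (List; length; filter; foldr; map; allFin)
open import Data.List.Relation.Unary.All using (All)
open import Data.List.Relation.Unary.Unique.Propositional using (Unique)
open import Data.List.Relation.Unary.AllPairs using (AllPairs)
open import Data.List.Relation.Binary.Sublist.Propositional using (_⊆_)
open import Data.Product using (_×_; Σ)
open import Relation.Binary.PropositionalEquality using (_≡_)

-- A family on vertex set Fin n: a list of subsets; distinctness is imposed via Unique.
Family : ℕ → Set
Family n = List (Subset n)

ThreeUniform : ∀ {n} → Family n → Set
ThreeUniform F = All (λ A → ∣ A ∣ ≡ 3) F

Linear : ∀ {n} → Family n → Set
Linear F = AllPairs (λ A B → ∣ A ∩ B ∣ ≤ 1) F

degree : ∀ {n} → Family n → Fin n → ℕ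
degree F x = length (filter (x ∈?_) F)

-- Δ(F) = max_x |F_x|  (0 if there are no vertices)
maxDegree : ∀ {n} → Family n → ℕ
maxDegree {n} F = foldr _⊔_ 0 (map (degree F) (allFin n))

IsMatching : ∀ {n} → Family n → Family n → Set
IsMatching F M = (M ⊆ F) × AllPairs (λ A B → Empty (A ∩ B)) M

IsMatchingNumber : ∀ {n} → Family n → ℕ → Set
IsMatchingNumber F k =
  Σ (Family _) (λ M → IsMatching F M × length M ≡ k) ×
  (∀ M → IsMatching F M → length M ≤ k)

-- Fix a maximum matching M and let each edge E send weight [E meets A] + [E meets A and no other member of M]
-- to every A ∈ M.  By maximality every edge meets M, so it sends weight at least 2, and 2|F| is at most the total
-- weight received by the members of M.  For A = {a,b,c} the weight A receives is less than Σ_v (deg v + t v), where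
-- t v < deg v ≤ d counts the edges E ≠ A through v that meet no other member of M.  Two disjoint such edges could
-- replace A in M, so any two of them meet; by linearity, once one of them passes through w, at most two pass
-- through any other u ∈ A, since those meet it in distinct points other than w.  Hence Σ t ≤ 6 or Σ t < d, so A
-- receives at most 4d ⊔ 20, and |F| ≤ (2d ⊔ 10) ν.

module Submission where

open import Defs
import Data.Bool as Bool
open import Data.Fin using (Fin; zero; suc)
import Data.Fin.Properties as Fin
open import Data.Fin.Subset using (Subset; _∩_; ∣_∣; _∈_; Empty; Nonempty; inside; outside)
open import Data.Fin.Subset.Properties using (_∈?_; nonempty?; x∈p∩q⁺; x∈p∩q⁻; ∩-comm)
open import Data.List using (List; []; _∷_; _++_; length; filter; map; allFin)
open import Data.List.Properties using (length-++; length-map; map-cong; foldr-forcesᵇ)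
import Data.List.Membership.DecPropositional as DecMembership
open import Data.List.Membership.Propositional using (find) renaming (_∈_ to _∈ₗ_)
open import Data.List.Membership.Propositional.Properties
  using (∈-∃++; ∈-++⁻; ∈-++⁺ˡ; ∈-++⁺ʳ; ∈-map⁺; ∈-map⁻; ∈-filter⁺; ∈-filter⁻; ∈-allFin)
open import Data.List.Relation.Binary.Sublist.Propositional.Properties using (Any-resp-⊆; filter-⊆)
open import Data.List.Relation.Unary.All as All using (All; []; _∷_)
import Data.List.Relation.Unary.All.Properties as All
open import Data.List.Relation.Unary.AllPairs using (AllPairs; []; _∷_)
import Data.List.Relation.Unary.AllPairs.Properties as AllPairs
open import Data.List.Relation.Unary.Any using (here; there)
open import Data.List.Relation.Unary.Unique.Propositional using (Unique)
import Data.List.Relation.Unary.Unique.Propositional.Properties as Unique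
open import Data.Nat using (ℕ; zero; suc; _+_; _*_; _≤_; _<_; _⊔_; z≤n; s≤s; z<s; _≤?_)
open import Data.Nat.ListAction using (sum)
open import Data.Nat.Properties
open import Algebra.Properties.CommutativeSemigroup +-commutativeSemigroup using (interchange)
open import Data.Nat.Tactic.RingSolver using (solve-∀)
open import Data.Product using (_×_; ∃; _,_; proj₁; proj₂; uncurry)
open import Data.Sum using (_⊎_; inj₁; inj₂; [_,_])
open import Data.Vec using ([]; _∷_; here; there)
open import Data.Vec.Properties using (≡-dec)
open import Function using (_∘_; id; flip)
open import Relation.Binary using (Symmetric; DecidableEquality)
open import Relation.Binary.PropositionalEquality
  using (_≡_; _≢_; refl; sym; trans; cong; cong₂; subst; module ≡-Reasoning)
open import Relation.Nullary using (Dec; yes; no; ¬_)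
open import Relation.Nullary.Decidable using (decidable-stable; ¬?; _×-dec_; _⊎-dec_)
open import Relation.Nullary.Negation using (contradiction)

private
  variable
    A : Set

∑ : List A → (A → ℕ) → ℕ
∑ xs f = sum (map f xs)

syntax ∑ xs (λ x → e) = ∑[ x ∈ xs ] e

∑-distrib-+ : ∀ xs (f g : A → ℕ) → ∑[ x ∈ xs ] (f x + g x) ≡ ∑ xs f + ∑ xs g
∑-distrib-+ []       f g = refl
∑-distrib-+ (x ∷ xs) f g = begin
  f x + g x + ∑[ y ∈ xs ] (f y + g y)   ≡⟨ cong (f x + g x +_) (∑-distrib-+ xs f g) ⟩
  f x + g x + (∑ xs f + ∑ xs g)         ≡⟨ interchange (f x) (g x) (∑ xs f) (∑ xs g) ⟩
  f x + ∑ xs f + (g x + ∑ xs g)         ∎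
  where open ≡-Reasoning

∑-comm : ∀ {B : Set} xs (ys : List B) (h : A → B → ℕ) →
         ∑[ x ∈ xs ] ∑[ y ∈ ys ] h x y ≡ ∑[ y ∈ ys ] ∑[ x ∈ xs ] h x y
∑-comm []       ys h = sym (∑-zero ys)
  where
  ∑-zero : ∀ {B : Set} (ys : List B) → ∑[ y ∈ ys ] 0 ≡ 0
  ∑-zero []       = refl
  ∑-zero (_ ∷ ys) = ∑-zero ys
∑-comm (x ∷ xs) ys h = begin
  ∑ ys (h x) + ∑[ x′ ∈ xs ] ∑[ y ∈ ys ] h x′ y   ≡⟨ cong (∑ ys (h x) +_) (∑-comm xs ys h) ⟩
  ∑ ys (h x) + ∑[ y ∈ ys ] ∑[ x′ ∈ xs ] h x′ y   ≡⟨ ∑-distrib-+ ys (h x) (λ y → ∑[ x′ ∈ xs ] h x′ y) ⟨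
  ∑[ y ∈ ys ] (h x y + ∑[ x′ ∈ xs ] h x′ y)      ∎
  where open ≡-Reasoning

∑-mono-≤ : ∀ xs {f g : A → ℕ} → (∀ {x} → x ∈ₗ xs → f x ≤ g x) → ∑ xs f ≤ ∑ xs g
∑-mono-≤ []       f≤g = z≤n
∑-mono-≤ (x ∷ xs) f≤g = +-mono-≤ (f≤g (here refl)) (∑-mono-≤ xs (f≤g ∘ there))

∑-lower : ∀ xs (f : A → ℕ) c → (∀ {x} → x ∈ₗ xs → c ≤ f x) → c * length xs ≤ ∑ xs f
∑-lower []       f c c≤f = ≤-reflexive (*-zeroʳ c)
∑-lower (x ∷ xs) f c c≤f = begin
  c * suc (length xs)   ≡⟨ *-suc c (length xs) ⟩
  c + c * length xs     ≤⟨ +-mono-≤ (c≤f (here refl)) (∑-lower xs f c (c≤f ∘ there)) ⟩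
  f x + ∑ xs f          ∎
  where open ≤-Reasoning

∑-upper : ∀ xs (f : A → ℕ) c → (∀ {x} → x ∈ₗ xs → f x ≤ c) → ∑ xs f ≤ c * length xs
∑-upper []       f c f≤c = ≤-reflexive (sym (*-zeroʳ c))
∑-upper (x ∷ xs) f c f≤c = begin
  f x + ∑ xs f          ≤⟨ +-mono-≤ (f≤c (here refl)) (∑-upper xs f c (f≤c ∘ there)) ⟩
  c + c * length xs     ≡⟨ *-suc c (length xs) ⟨
  c * suc (length xs)   ∎
  where open ≤-Reasoning

term≤∑ : ∀ {xs} (f : A → ℕ) {x} → x ∈ₗ xs → f x ≤ ∑ xs f
term≤∑ f (here refl) = m≤m+n _ _
term≤∑ f (there {x = y} x∈xs) = ≤-trans (term≤∑ f x∈xs) (m≤n+m _ (f y))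

two-terms≤∑ : ∀ {xs} (f : A → ℕ) {x y} → x ∈ₗ xs → y ∈ₗ xs → x ≢ y → f x + f y ≤ ∑ xs f
two-terms≤∑ f (here refl)  (here refl)  x≢y = contradiction refl x≢y
two-terms≤∑ f (here refl)  (there y∈xs) x≢y = +-monoʳ-≤ (f _) (term≤∑ f y∈xs)
two-terms≤∑ f {x} {y} (there {xs = xs} x∈xs) (here refl) x≢y =
  subst (_≤ f y + ∑ xs f) (+-comm (f y) (f x)) (+-monoʳ-≤ (f y) (term≤∑ f x∈xs))
two-terms≤∑ f (there {x = z} x∈xs) (there y∈xs) x≢y =
  ≤-trans (two-terms≤∑ f x∈xs y∈xs x≢y) (m≤n+m _ (f z))

𝟙 : {P : Set} → Dec P → ℕ
𝟙 (yes _) = 1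
𝟙 (no _)  = 0

𝟙≤1 : {P : Set} (p? : Dec P) → 𝟙 p? ≤ 1
𝟙≤1 (yes _) = ≤-refl
𝟙≤1 (no _)  = z≤n

1≤𝟙 : {P : Set} (p? : Dec P) → P → 1 ≤ 𝟙 p?
1≤𝟙 (yes _) _  = ≤-refl
1≤𝟙 (no ¬p) p = contradiction p ¬p

𝟙≡0 : {P : Set} (p? : Dec P) → ¬ P → 𝟙 p? ≡ 0
𝟙≡0 (yes p) ¬p = contradiction p ¬p
𝟙≡0 (no _)  ¬p = refl

𝟙-mono : {P Q : Set} (p? : Dec P) (q? : Dec Q) → (P → Q) → 𝟙 p? ≤ 𝟙 q?
𝟙-mono (yes p) q? P→Q = 1≤𝟙 q? (P→Q p)
𝟙-mono (no _)  q? P→Q = z≤n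

length-filter≡∑𝟙 : {P : A → Set} (P? : ∀ x → Dec (P x)) (xs : List A) →
                   length (filter P? xs) ≡ ∑[ x ∈ xs ] 𝟙 (P? x)
length-filter≡∑𝟙 P? []       = refl
length-filter≡∑𝟙 P? (x ∷ xs) with P? x
... | yes _ = cong suc (length-filter≡∑𝟙 P? xs)
... | no _  = length-filter≡∑𝟙 P? xs

unique⇒length≤ : ∀ {xs ys : List A} → Unique xs → All (_∈ₗ ys) xs → length xs ≤ length ys
unique⇒length≤ [] [] = z≤n
unique⇒length≤ {xs = x ∷ xs} (x∉xs ∷ xs!) (x∈ys ∷ xs⊆ys) with ∈-∃++ x∈ys
... | us , vs , refl = begin
  suc (length xs)              ≤⟨ s≤s (unique⇒length≤ xs! (All.zipWith (uncurry skip) (x∉xs , xs⊆ys))) ⟩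
  suc (length (us ++ vs))      ≡⟨ cong suc (length-++ us) ⟩
  suc (length us + length vs)  ≡⟨ +-suc (length us) (length vs) ⟨
  length us + length (x ∷ vs)  ≡⟨ length-++ us ⟨
  length (us ++ x ∷ vs)        ∎
  where
  open ≤-Reasoning
  skip : ∀ {y} → x ≢ y → y ∈ₗ us ++ x ∷ vs → y ∈ₗ us ++ vs
  skip x≢y y∈ with ∈-++⁻ us y∈
  ... | inj₁ y∈us         = ∈-++⁺ˡ y∈us
  ... | inj₂ (here y≡x)   = contradiction (sym y≡x) x≢y
  ... | inj₂ (there y∈vs) = ∈-++⁺ʳ us y∈vs

length>0⇒∈ : ∀ {xs : List A} → 0 < length xs → ∃ (_∈ₗ xs)
length>0⇒∈ {xs = x ∷ _} _ = x , here refl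

AllPairs-∈ : ∀ {R : A → A → Set} → Symmetric R →
             ∀ {xs x y} → AllPairs R xs → x ∈ₗ xs → y ∈ₗ xs → x ≢ y → R x y
AllPairs-∈ R-sym (Rx ∷ Rxs) (here refl) (here refl) x≢y = contradiction refl x≢y
AllPairs-∈ R-sym (Rx ∷ Rxs) (here refl) (there y∈) x≢y = All.lookup Rx y∈
AllPairs-∈ R-sym (Rx ∷ Rxs) (there x∈) (here refl) x≢y = R-sym (All.lookup Rx x∈)
AllPairs-∈ R-sym (Rx ∷ Rxs) (there x∈) (there y∈) x≢y = AllPairs-∈ R-sym Rxs x∈ y∈ x≢y

distinct⇒AllPairs : ∀ {R : A → A → Set} {ys} → (∀ {x y} → x ∈ₗ ys → y ∈ₗ ys → x ≢ y → R x y) →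
                    ∀ {xs} → Unique xs → All (_∈ₗ ys) xs → AllPairs R xs
distinct⇒AllPairs R-distinct [] [] = []
distinct⇒AllPairs R-distinct (x∉xs ∷ xs!) (x∈ys ∷ xs⊆ys) =
  All.zipWith (λ (x≢y , y∈ys) → R-distinct x∈ys y∈ys x≢y) (x∉xs , xs⊆ys) ∷ distinct⇒AllPairs R-distinct xs! xs⊆ys

elements : ∀ {n} → Subset n → List (Fin n)
elements []            = []
elements (inside ∷ p)  = zero ∷ map suc (elements p)
elements (outside ∷ p) = map suc (elements p)

∈-elements⁺ : ∀ {n} {p : Subset n} {x} → x ∈ p → x ∈ₗ elements p
∈-elements⁺ {p = inside ∷ p}  here        = here refl
∈-elements⁺ {p = inside ∷ p}  (there x∈p) = there (∈-map⁺ suc (∈-elements⁺ x∈p))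
∈-elements⁺ {p = outside ∷ p} (there x∈p) = ∈-map⁺ suc (∈-elements⁺ x∈p)

∈-elements⁻ : ∀ {n} (p : Subset n) {x} → x ∈ₗ elements p → x ∈ p
∈-elements⁻ (inside ∷ p) (here refl) = here
∈-elements⁻ (inside ∷ p) (there x∈) with ∈-map⁻ suc x∈
... | y , y∈ , refl = there (∈-elements⁻ p y∈)
∈-elements⁻ (outside ∷ p) x∈ with ∈-map⁻ suc x∈
... | y , y∈ , refl = there (∈-elements⁻ p y∈)

elements-unique : ∀ {n} (p : Subset n) → Unique (elements p)
elements-unique []            = []
elements-unique (inside ∷ p)  = zero∉ ∷ Unique.map⁺ Fin.suc-injective (elements-unique p)
  where
  zero∉ : All (zero ≢_) (map suc (elements p))
  zero∉ = All.map⁺ (All.universal (λ _ ()) (elements p))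
elements-unique (outside ∷ p) = Unique.map⁺ Fin.suc-injective (elements-unique p)

length-elements : ∀ {n} (p : Subset n) → length (elements p) ≡ ∣ p ∣
length-elements []            = refl
length-elements (inside ∷ p)  = cong suc (trans (length-map suc (elements p)) (length-elements p))
length-elements (outside ∷ p) = trans (length-map suc (elements p)) (length-elements p)

length≤∣p∣ : ∀ {n} {p : Subset n} {xs} → Unique xs → All (_∈ p) xs → length xs ≤ ∣ p ∣
length≤∣p∣ {p = p} xs! xs⊆p = subst (_ ≤_) (length-elements p) (unique⇒length≤ xs! (All.map ∈-elements⁺ xs⊆p))

0<∣p∣⇒Nonempty : ∀ {n} (p : Subset n) → 0 < ∣ p ∣ → Nonempty p
0<∣p∣⇒Nonempty p 0<∣p∣ with length>0⇒∈ (subst (0 <_) (sym (length-elements p)) 0<∣p∣)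
... | x , x∈ = x , ∈-elements⁻ p x∈

∣∩∣≤1⇒≡ : ∀ {n} {X Y : Subset n} {x y} → ∣ X ∩ Y ∣ ≤ 1 → x ∈ X → x ∈ Y → y ∈ X → y ∈ Y → x ≡ y
∣∩∣≤1⇒≡ {x = x} {y} ∣X∩Y∣≤1 x∈X x∈Y y∈X y∈Y with x Fin.≟ y
... | yes x≡y = x≡y
... | no  x≢y = contradiction (≤-trans 2≤∣X∩Y∣ ∣X∩Y∣≤1) 1+n≰n
  where
  2≤∣X∩Y∣ = length≤∣p∣ ((x≢y ∷ []) ∷ [] ∷ []) (x∈p∩q⁺ (x∈X , x∈Y) ∷ x∈p∩q⁺ (y∈X , y∈Y) ∷ [])

_≟ₛ_ : ∀ {n} → DecidableEquality (Subset n)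
_≟ₛ_ = ≡-dec Bool._≟_

Meets : ∀ {n} → Subset n → Subset n → Set
Meets X Y = Nonempty (X ∩ Y)

Disjoint : ∀ {n} → Subset n → Subset n → Set
Disjoint X Y = Empty (X ∩ Y)

meets? : ∀ {n} (X Y : Subset n) → Dec (Meets X Y)
meets? X Y = nonempty? (X ∩ Y)

disjoint? : ∀ {n} (X Y : Subset n) → Dec (Disjoint X Y)
disjoint? X Y = ¬? (meets? X Y)

Disjoint-sym : ∀ {n} → Symmetric (Disjoint {n})
Disjoint-sym {x = X} {Y} X∩Y≡∅ (x , x∈Y∩X) = X∩Y≡∅ (x , subst (x ∈_) (∩-comm Y X) x∈Y∩X)

Nonempty⇒¬Disjoint-self : ∀ {n} {X : Subset n} → Nonempty X → ¬ Disjoint X X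
Nonempty⇒¬Disjoint-self (x , x∈X) X∩X≡∅ = X∩X≡∅ (x , x∈p∩q⁺ (x∈X , x∈X))

degree≤maxDegree : ∀ {n} (F : Family n) x → degree F x ≤ maxDegree F
degree≤maxDegree {n} F x = All.lookup degrees≤ (∈-map⁺ (degree F) (∈-allFin x))
  where
  degrees≤ : All (_≤ maxDegree F) (map (degree F) (allFin n))
  degrees≤ = foldr-forcesᵇ (λ a b a⊔b≤ → m⊔n≤o⇒m≤o a b a⊔b≤ , m⊔n≤o⇒n≤o a b a⊔b≤) 0 _ ≤-refl

Compatible : ℕ → ℕ → Set
Compatible s t = (0 < s → t ≤ 2) × (0 < t → s ≤ 2)

compatible-triple : ∀ {d ta tb tc} → ta < d → tb < d → tc < d →
              Compatible ta tb → Compatible ta tc → Compatible tb tc →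
              ta + tb + tc ≤ 6 ⊎ ta + tb + tc < d
compatible-triple         {ta = zero}  {zero}  {tc}    _    _    tc<d _ _ _ = inj₂ tc<d
compatible-triple {d = d} {ta = zero}  {suc _} {zero}  _    tb<d _    _ _ _ =
  inj₂ (subst (_< d) (sym (+-identityʳ _)) tb<d)
compatible-triple {d = d} {ta = suc _} {zero}  {zero}  ta<d _    _    _ _ _ =
  inj₂ (subst (_< d) (sym (trans (+-identityʳ _) (+-identityʳ _))) ta<d)
compatible-triple {ta = zero}  {suc _} {suc _}  _ _ _ _ _ (tc≤2 , tb≤2) =
  inj₁ (+-mono-≤ (+-mono-≤ (z≤n {2}) (tb≤2 z<s)) (tc≤2 z<s))
compatible-triple {ta = suc _} {zero}  {suc _}  _ _ _ _ (tc≤2 , ta≤2) _ =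
  inj₁ (+-mono-≤ (+-mono-≤ (ta≤2 z<s) (z≤n {2})) (tc≤2 z<s))
compatible-triple {ta = suc _} {suc _} {zero}   _ _ _ (tb≤2 , ta≤2) _ _ =
  inj₁ (+-mono-≤ (+-mono-≤ (ta≤2 z<s) (tb≤2 z<s)) (z≤n {2}))
compatible-triple {ta = suc _} {suc _} {suc _}  _ _ _ (tb≤2 , ta≤2) (tc≤2 , _) _ =
  inj₁ (+-mono-≤ (+-mono-≤ (ta≤2 z<s) (tb≤2 z<s)) (tc≤2 z<s))

≤2[2d⊔10] : ∀ {S D T d} → S + 1 ≤ D + T → D ≤ d * 3 → T ≤ 6 ⊎ T < d → S ≤ 2 * (2 * d ⊔ 10)
≤2[2d⊔10] {S} {D} {T} {d} S+1≤D+T D≤3d (inj₂ T<d) = begin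
  S                 ≤⟨ m≤m+n S 1 ⟩
  S + 1             ≤⟨ S+1≤D+T ⟩
  D + T             ≤⟨ +-mono-≤ D≤3d (<⇒≤ T<d) ⟩
  d * 3 + d         ≡⟨ 3d+d≡2[2d] d ⟩
  2 * (2 * d)       ≤⟨ *-monoʳ-≤ 2 (m≤m⊔n (2 * d) 10) ⟩
  2 * (2 * d ⊔ 10)  ∎
  where
  open ≤-Reasoning
  3d+d≡2[2d] : ∀ d → d * 3 + d ≡ 2 * (2 * d)
  3d+d≡2[2d] = solve-∀
≤2[2d⊔10] {S} {D} {T} {d} S+1≤D+T D≤3d (inj₁ T≤6) = +-cancelʳ-≤ 1 S _ (begin
  S + 1                   ≤⟨ S+1≤D+T ⟩
  D + T                   ≤⟨ +-mono-≤ D≤3d T≤6 ⟩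
  d * 3 + 6               ≤⟨ small-or-large (5 ≤? d) ⟩
  2 * (2 * d ⊔ 10) + 1    ∎)
  where
  open ≤-Reasoning
  3d+[d+1]≡2[2d]+1 : ∀ d → d * 3 + (d + 1) ≡ 2 * (2 * d) + 1
  3d+[d+1]≡2[2d]+1 = solve-∀
  small-or-large : Dec (5 ≤ d) → d * 3 + 6 ≤ 2 * (2 * d ⊔ 10) + 1
  small-or-large (yes 5≤d) = begin
    d * 3 + 6          ≤⟨ +-monoʳ-≤ (d * 3) (+-monoˡ-≤ 1 5≤d) ⟩
    d * 3 + (d + 1)    ≡⟨ 3d+[d+1]≡2[2d]+1 d ⟩
    2 * (2 * d) + 1    ≤⟨ +-monoˡ-≤ 1 (*-monoʳ-≤ 2 (m≤m⊔n (2 * d) 10)) ⟩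
    2 * (2 * d ⊔ 10) + 1 ∎
  small-or-large (no 5≰d) = begin
    d * 3 + 6          ≤⟨ +-monoˡ-≤ 6 (*-monoˡ-≤ 3 (≤-pred (≰⇒> 5≰d))) ⟩
    4 * 3 + 6          ≤⟨ m≤m+n 18 3 ⟩
    2 * 10 + 1         ≤⟨ +-monoˡ-≤ 1 (*-monoʳ-≤ 2 (m≤n⊔m (2 * d) 10)) ⟩
    2 * (2 * d ⊔ 10) + 1 ∎

-- Double counting against a maximum matching

module MaximumMatching {n : ℕ} {F : Family n} (F! : Unique F) (threeF : ThreeUniform F) (linearF : Linear F)
                       {M : Family n} (matchingM : IsMatching F M)
                       (maximumM : ∀ M′ → IsMatching F M′ → length M′ ≤ length M) where

  open DecMembership (_≟ₛ_ {n}) using () renaming (_∈?_ to _∈ₗ?_)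

  ∈M⇒∈F : ∀ {A} → A ∈ₗ M → A ∈ₗ F
  ∈M⇒∈F = Any-resp-⊆ (proj₁ matchingM)

  disjointM : AllPairs Disjoint M
  disjointM = proj₂ matchingM

  member-nonempty : ∀ {E} → E ∈ₗ F → Nonempty E
  member-nonempty E∈F = 0<∣p∣⇒Nonempty _ (subst (0 <_) (sym (All.lookup threeF E∈F)) z<s)

  shared-vertex : ∀ {X Y x y} → X ∈ₗ F → Y ∈ₗ F → X ≢ Y → x ∈ X → x ∈ Y → y ∈ X → y ∈ Y → x ≡ y
  shared-vertex X∈F Y∈F X≢Y =
    ∣∩∣≤1⇒≡ (AllPairs-∈ {R = AtMostOneShared} (λ {X} {Y} → ∣∩∣≤1-sym {X} {Y}) linearF X∈F Y∈F X≢Y)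
    where
    AtMostOneShared : Subset n → Subset n → Set
    AtMostOneShared X Y = ∣ X ∩ Y ∣ ≤ 1
    ∣∩∣≤1-sym : Symmetric AtMostOneShared
    ∣∩∣≤1-sym {X} {Y} = subst (λ Z → ∣ Z ∣ ≤ 1) (∩-comm X Y)

  disjoint⇒unique : ∀ {L} → All (_∈ₗ F) L → AllPairs Disjoint L → Unique L
  disjoint⇒unique []           []          = []
  disjoint⇒unique (X∈F ∷ L⊆F) (X#L ∷ L#) =
    All.map (λ X#Y X≡Y → Nonempty⇒¬Disjoint-self (member-nonempty X∈F) (subst (Disjoint _) (sym X≡Y) X#Y)) X#L
    ∷ disjoint⇒unique L⊆F L#

  matching-bound : ∀ {L} → All (_∈ₗ F) L → AllPairs Disjoint L → length L ≤ length M
  matching-bound {L} L⊆F L# = begin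
    length L   ≤⟨ unique⇒length≤ (disjoint⇒unique L⊆F L#) (All.tabulate L⊆L′) ⟩
    length L′  ≤⟨ maximumM L′ (filter-⊆ (_∈ₗ? L) F , L′#) ⟩
    length M   ∎
    where
    open ≤-Reasoning
    L′ = filter (_∈ₗ? L) F
    L⊆L′ : ∀ {X} → X ∈ₗ L → X ∈ₗ L′
    L⊆L′ X∈L = ∈-filter⁺ (_∈ₗ? L) (All.lookup L⊆F X∈L) X∈L
    L′# : AllPairs Disjoint L′
    L′# = distinct⇒AllPairs (AllPairs-∈ Disjoint-sym L#) (Unique.filter⁺ (_∈ₗ? L) F!)
                            (All.tabulate (proj₂ ∘ ∈-filter⁻ (_∈ₗ? L) {xs = F}))

  meets-matching : ∀ {E} → E ∈ₗ F → ∃ λ A → A ∈ₗ M × Meets E A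
  meets-matching {E} E∈F with All.all? (disjoint? E) M
  ... | yes E#M = contradiction (matching-bound (E∈F ∷ All.tabulate ∈M⇒∈F) (E#M ∷ disjointM)) 1+n≰n
  ... | no ¬E#M with find (All.¬All⇒Any¬ (disjoint? E) M ¬E#M)
  ...   | A , A∈M , ¬E#A = A , A∈M , decidable-stable (meets? E A) ¬E#A

  MeetsOnly : Subset n → Subset n → Set
  MeetsOnly A E = Meets E A × All (λ B → B ≡ A ⊎ Disjoint E B) M

  meetsOnly? : ∀ A E → Dec (MeetsOnly A E)
  meetsOnly? A E = meets? E A ×-dec All.all? (λ B → (B ≟ₛ A) ⊎-dec disjoint? E B) M

  -- Otherwise E₁ and E₂ could replace A in M.
  exchange : ∀ {A E₁ E₂} → A ∈ₗ M → E₁ ∈ₗ F → E₂ ∈ₗ F → MeetsOnly A E₁ → MeetsOnly A E₂ → Meets E₁ E₂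
  exchange {A} {E₁} {E₂} A∈M E₁∈F E₂∈F (_ , only₁) (_ , only₂) =
    decidable-stable (meets? E₁ E₂) λ E₁#E₂ → 1+n≰n (begin
      2 + length M⁻  ≤⟨ matching-bound (E₁∈F ∷ E₂∈F ∷ All.tabulate (∈M⇒∈F ∘ proj₁ ∘ ∈M⁻⇒))
                                       ((E₁#E₂ ∷ avoids only₁) ∷ avoids only₂ ∷ AllPairs.filter⁺ _ disjointM) ⟩
      length M       ≤⟨ unique⇒length≤ (disjoint⇒unique (All.tabulate ∈M⇒∈F) disjointM) (All.tabulate reinsert) ⟩
      1 + length M⁻  ∎)
    where
    open ≤-Reasoning
    M⁻ = filter (λ B → ¬? (B ≟ₛ A)) M
    ∈M⁻⇒ : ∀ {B} → B ∈ₗ M⁻ → B ∈ₗ M × B ≢ A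
    ∈M⁻⇒ = ∈-filter⁻ (λ B → ¬? (B ≟ₛ A)) {xs = M}
    reinsert : ∀ {B} → B ∈ₗ M → B ∈ₗ A ∷ M⁻
    reinsert {B} B∈M with B ≟ₛ A
    ... | yes B≡A = here B≡A
    ... | no  B≢A = there (∈-filter⁺ (λ B → ¬? (B ≟ₛ A)) B∈M B≢A)
    avoids : ∀ {E} → All (λ B → B ≡ A ⊎ Disjoint E B) M → All (Disjoint E) M⁻
    avoids only = All.tabulate λ B∈M⁻ →
      let B∈M , B≢A = ∈M⁻⇒ B∈M⁻ in [ flip contradiction B≢A , id ] (All.lookup only B∈M)

  weight : Subset n → Subset n → ℕ
  weight E A = 𝟙 (meets? E A) + 𝟙 (meetsOnly? A E)

  1≤weight : ∀ {E A} → Meets E A → 1 ≤ weight E A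
  1≤weight {E} {A} E∩A = ≤-trans (1≤𝟙 (meets? E A) E∩A) (m≤m+n _ _)

  2≤∑weight : ∀ {E} → E ∈ₗ F → 2 ≤ ∑[ A ∈ M ] weight E A
  2≤∑weight {E} E∈F with meets-matching E∈F
  ... | A , A∈M , E∩A with meetsOnly? A E
  ...   | yes only =
    ≤-trans (+-mono-≤ (1≤𝟙 (meets? E A) E∩A) (1≤𝟙 (meetsOnly? A E) only)) (term≤∑ (weight E) A∈M)
  ...   | no ¬only with find (All.¬All⇒Any¬ (λ B → (B ≟ₛ A) ⊎-dec disjoint? E B) M (¬only ∘ (E∩A ,_)))
  ...     | B , B∈M , ¬[B≡A⊎E#B] =
    ≤-trans (+-mono-≤ (1≤weight E∩A) (1≤weight E∩B))
            (two-terms≤∑ (weight E) A∈M B∈M (¬[B≡A⊎E#B] ∘ inj₁ ∘ sym))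
    where
    E∩B : Meets E B
    E∩B = decidable-stable (meets? E B) (¬[B≡A⊎E#B] ∘ inj₂)

  module AtMatchingEdge {A} (A∈M : A ∈ₗ M) where

    A∈F : A ∈ₗ F
    A∈F = ∈M⇒∈F A∈M

    PrivateThrough : Fin n → Subset n → Set
    PrivateThrough v E = v ∈ E × E ≢ A × MeetsOnly A E

    privateThrough? : ∀ v E → Dec (PrivateThrough v E)
    privateThrough? v E = (v ∈? E) ×-dec (¬? (E ≟ₛ A) ×-dec meetsOnly? A E)

    PrivateEdge : Fin n → Subset n → Set
    PrivateEdge v E = E ∈ₗ F × PrivateThrough v E

    privateDegree : Fin n → ℕ
    privateDegree v = length (filter (privateThrough? v) F)

    vertexWeight : Fin n → Subset n → ℕ
    vertexWeight v E = 𝟙 (v ∈? E) + 𝟙 (privateThrough? v E)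

    1≤∑[E≟A] : 1 ≤ ∑[ E ∈ F ] 𝟙 (E ≟ₛ A)
    1≤∑[E≟A] = ≤-trans (1≤𝟙 (A ≟ₛ A) refl) (term≤∑ (λ E → 𝟙 (E ≟ₛ A)) A∈F)

    weight≤vertexWeight : ∀ {x E} → x ∈ E → x ∈ A → E ≢ A → weight E A ≤ vertexWeight x E
    weight≤vertexWeight {x} {E} x∈E x∈A E≢A =
      +-mono-≤ (≤-trans (𝟙≤1 (meets? E A)) (1≤𝟙 (x ∈? E) x∈E))
               (𝟙-mono (meetsOnly? A E) (privateThrough? x E) (λ only → x∈E , E≢A , only))

    weight-split : ∀ E → weight E A + 𝟙 (E ≟ₛ A) ≤ ∑[ v ∈ elements A ] vertexWeight v E
    weight-split E = split (E ≟ₛ A)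
      where
      split : (E≟A : Dec (E ≡ A)) → weight E A + 𝟙 E≟A ≤ ∑[ v ∈ elements A ] vertexWeight v E
      split (yes refl) = begin
        weight A A + 1                          ≤⟨ +-monoˡ-≤ 1 (+-mono-≤ (𝟙≤1 (meets? A A)) (𝟙≤1 (meetsOnly? A A))) ⟩
        3                                       ≡⟨ trans (*-identityˡ _) (trans (length-elements A) (All.lookup threeF A∈F)) ⟨
        1 * length (elements A)                 ≤⟨ ∑-lower (elements A) (λ v → 𝟙 (v ∈? A)) 1 (1≤𝟙 (_ ∈? A) ∘ ∈-elements⁻ A) ⟩
        ∑[ v ∈ elements A ] 𝟙 (v ∈? A)          ≤⟨ ∑-mono-≤ (elements A) (λ _ → m≤m+n _ _) ⟩
        ∑[ v ∈ elements A ] vertexWeight v A    ∎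
        where open ≤-Reasoning
      split (no E≢A) = ≤-trans (≤-reflexive (+-identityʳ _)) (meeting (meets? E A))
        where
        meeting : Dec (Meets E A) → weight E A ≤ ∑[ v ∈ elements A ] vertexWeight v E
        meeting (yes (x , x∈E∩A)) =
          let x∈E , x∈A = x∈p∩q⁻ E A x∈E∩A
          in ≤-trans (weight≤vertexWeight x∈E x∈A E≢A) (term≤∑ (λ v → vertexWeight v E) (∈-elements⁺ x∈A))
        meeting (no ¬E∩A) = ≤-trans (≤-reflexive weight≡0) z≤n
          where
          weight≡0 : weight E A ≡ 0
          weight≡0 = cong₂ _+_ (𝟙≡0 (meets? E A) ¬E∩A) (𝟙≡0 (meetsOnly? A E) (¬E∩A ∘ proj₁))

    ∑weight+1≤∑degrees : ∑[ E ∈ F ] weight E A + 1 ≤ ∑[ v ∈ elements A ] (degree F v + privateDegree v)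
    ∑weight+1≤∑degrees = begin
      ∑[ E ∈ F ] weight E A + 1                               ≤⟨ +-monoʳ-≤ _ 1≤∑[E≟A] ⟩
      ∑[ E ∈ F ] weight E A + ∑[ E ∈ F ] 𝟙 (E ≟ₛ A)           ≡⟨ ∑-distrib-+ F (λ E → weight E A) (λ E → 𝟙 (E ≟ₛ A)) ⟨
      ∑[ E ∈ F ] (weight E A + 𝟙 (E ≟ₛ A))                    ≤⟨ ∑-mono-≤ F (λ {E} _ → weight-split E) ⟩
      ∑[ E ∈ F ] ∑[ v ∈ elements A ] vertexWeight v E         ≡⟨ ∑-comm F (elements A) (flip vertexWeight) ⟩
      ∑[ v ∈ elements A ] ∑[ E ∈ F ] vertexWeight v E         ≡⟨ cong sum (map-cong vertexWeight-sum (elements A)) ⟩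
      ∑[ v ∈ elements A ] (degree F v + privateDegree v)      ∎
      where
      open ≤-Reasoning
      vertexWeight-sum : ∀ v → ∑[ E ∈ F ] vertexWeight v E ≡ degree F v + privateDegree v
      vertexWeight-sum v = begin-equality
        ∑[ E ∈ F ] vertexWeight v E                                       ≡⟨ ∑-distrib-+ F _ _ ⟩
        ∑[ E ∈ F ] 𝟙 (v ∈? E) + ∑[ E ∈ F ] 𝟙 (privateThrough? v E)       ≡⟨ cong₂ _+_ (length-filter≡∑𝟙 (v ∈?_) F)
                                                                                          (length-filter≡∑𝟙 (privateThrough? v) F) ⟨
        degree F v + privateDegree v                                      ∎

    privateDegree<degree : ∀ {v} → v ∈ A → privateDegree v < degree F v
    privateDegree<degree {v} v∈A = begin
      suc (privateDegree v)                                   ≡⟨ +-comm 1 _ ⟩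
      privateDegree v + 1                                     ≤⟨ +-monoʳ-≤ _ 1≤∑[E≟A] ⟩
      privateDegree v + ∑[ E ∈ F ] 𝟙 (E ≟ₛ A)                 ≡⟨ cong (_+ _) (length-filter≡∑𝟙 (privateThrough? v) F) ⟩
      ∑[ E ∈ F ] 𝟙 (privateThrough? v E) + ∑[ E ∈ F ] 𝟙 (E ≟ₛ A)
                                                               ≡⟨ ∑-distrib-+ F _ _ ⟨
      ∑[ E ∈ F ] (𝟙 (privateThrough? v E) + 𝟙 (E ≟ₛ A))       ≤⟨ ∑-mono-≤ F (λ {E} _ → split E (E ≟ₛ A)) ⟩
      ∑[ E ∈ F ] 𝟙 (v ∈? E)                                   ≡⟨ length-filter≡∑𝟙 (v ∈?_) F ⟨
      degree F v                                              ∎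
      where
      open ≤-Reasoning
      split : ∀ E (E≟A : Dec (E ≡ A)) → 𝟙 (privateThrough? v E) + 𝟙 E≟A ≤ 𝟙 (v ∈? E)
      split E (yes refl) = begin
        𝟙 (privateThrough? v A) + 1   ≡⟨ cong (_+ 1) (𝟙≡0 (privateThrough? v A) (λ (_ , A≢A , _) → A≢A refl)) ⟩
        1                             ≤⟨ 1≤𝟙 (v ∈? A) v∈A ⟩
        𝟙 (v ∈? A)                    ∎
      split E (no _) = ≤-trans (≤-reflexive (+-identityʳ _)) (𝟙-mono (privateThrough? v E) (v ∈? E) proj₁)

    module Crossing {u w Eb} (u∈A : u ∈ A) (w∈A : w ∈ A) (u≢w : u ≢ w)
                    (Eb∈F : Eb ∈ₗ F) (w∈Eb : w ∈ Eb) (Eb≢A : Eb ≢ A) (onlyEb : MeetsOnly A Eb) where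

      crossing : ∀ {E} → PrivateEdge u E → ∃ λ x → x ∈ E × x ∈ Eb
      crossing {E} (E∈F , _ , _ , onlyE) with exchange A∈M E∈F Eb∈F onlyE onlyEb
      ... | x , x∈E∩Eb = x , x∈p∩q⁻ E Eb x∈E∩Eb

      point : ∀ {E} → PrivateEdge u E → Fin n
      point = proj₁ ∘ crossing

      point∈E : ∀ {E} (p : PrivateEdge u E) → point p ∈ E
      point∈E = proj₁ ∘ proj₂ ∘ crossing

      point∈Eb : ∀ {E} (p : PrivateEdge u E) → point p ∈ Eb
      point∈Eb = proj₂ ∘ proj₂ ∘ crossing

      w≢point : ∀ {E} (p : PrivateEdge u E) → w ≢ point p
      w≢point p@(E∈F , u∈E , E≢A , _) w≡x =
        u≢w (shared-vertex E∈F A∈F E≢A u∈E u∈A (subst (_∈ _) (sym w≡x) (point∈E p)) w∈A)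

      point≢u : ∀ {E} (p : PrivateEdge u E) → point p ≢ u
      point≢u p x≡u =
        u≢w (shared-vertex Eb∈F A∈F Eb≢A (subst (_∈ Eb) x≡u (point∈Eb p)) u∈A w∈Eb w∈A)

      points-distinct : ∀ {E E′} (p : PrivateEdge u E) (p′ : PrivateEdge u E′) → E ≢ E′ → point p ≢ point p′
      points-distinct p@(E∈F , u∈E , _) p′@(E′∈F , u∈E′ , _) E≢E′ x≡x′ =
        point≢u p (sym (shared-vertex E∈F E′∈F E≢E′ u∈E u∈E′ (point∈E p)
                                       (subst (_∈ _) (sym x≡x′) (point∈E p′))))

    at-most-two-private : ∀ {u w Eb} → u ∈ A → w ∈ A → u ≢ w → PrivateEdge w Eb →
                          ∀ {Es} → Unique Es → All (PrivateEdge u) Es → length Es ≤ 2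
    at-most-two-private _ _ _ _ {[]}         _ _ = z≤n
    at-most-two-private _ _ _ _ {_ ∷ []}     _ _ = s≤s z≤n
    at-most-two-private _ _ _ _ {_ ∷ _ ∷ []} _ _ = s≤s (s≤s z≤n)
    at-most-two-private {w = w} {Eb} u∈A w∈A u≢w (Eb∈F , w∈Eb , Eb≢A , onlyEb) {E₁ ∷ E₂ ∷ E₃ ∷ _}
                        ((E₁≢E₂ ∷ E₁≢E₃ ∷ _) ∷ (E₂≢E₃ ∷ _) ∷ _) (p₁ ∷ p₂ ∷ p₃ ∷ _) =
      contradiction (subst (4 ≤_) (All.lookup threeF Eb∈F) (length≤∣p∣ four-distinct four∈Eb)) 1+n≰n
      where
      open Crossing u∈A w∈A u≢w Eb∈F w∈Eb Eb≢A onlyEb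
      four-distinct : Unique (w ∷ point p₁ ∷ point p₂ ∷ point p₃ ∷ [])
      four-distinct = (w≢point p₁ ∷ w≢point p₂ ∷ w≢point p₃ ∷ [])
                    ∷ (points-distinct p₁ p₂ E₁≢E₂ ∷ points-distinct p₁ p₃ E₁≢E₃ ∷ [])
                    ∷ (points-distinct p₂ p₃ E₂≢E₃ ∷ [])
                    ∷ [] ∷ []
      four∈Eb : All (_∈ Eb) (w ∷ point p₁ ∷ point p₂ ∷ point p₃ ∷ [])
      four∈Eb = w∈Eb ∷ point∈Eb p₁ ∷ point∈Eb p₂ ∷ point∈Eb p₃ ∷ []

    privateDegree≤2 : ∀ {u w} → u ∈ A → w ∈ A → u ≢ w → 0 < privateDegree w → privateDegree u ≤ 2
    privateDegree≤2 {u} {w} u∈A w∈A u≢w 0<pdw with length>0⇒∈ 0<pdw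
    ... | Eb , Eb∈ =
      at-most-two-private u∈A w∈A u≢w (∈-filter⁻ (privateThrough? w) {xs = F} Eb∈)
                          (Unique.filter⁺ (privateThrough? u) F!)
                          (All.tabulate (∈-filter⁻ (privateThrough? u) {xs = F}))

    compatible : ∀ {u w} → u ∈ A → w ∈ A → u ≢ w → Compatible (privateDegree u) (privateDegree w)
    compatible u∈A w∈A u≢w = privateDegree≤2 w∈A u∈A (u≢w ∘ sym) , privateDegree≤2 u∈A w∈A u≢w

    ∑privateDegree-bound : ∀ {vs} → Unique vs → All (_∈ A) vs → length vs ≡ 3 →
                           ∑ vs privateDegree ≤ 6 ⊎ ∑ vs privateDegree < maxDegree F
    ∑privateDegree-bound {a ∷ b ∷ c ∷ []} ((a≢b ∷ a≢c ∷ []) ∷ (b≢c ∷ []) ∷ [] ∷ []) (a∈A ∷ b∈A ∷ c∈A ∷ []) refl =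
      subst (λ T → T ≤ 6 ⊎ T < maxDegree F) (sum-of-three privateDegree)
        (compatible-triple (<Δ a∈A) (<Δ b∈A) (<Δ c∈A)
                           (compatible a∈A b∈A a≢b) (compatible a∈A c∈A a≢c) (compatible b∈A c∈A b≢c))
      where
      <Δ : ∀ {v} → v ∈ A → privateDegree v < maxDegree F
      <Δ {v} v∈A = <-≤-trans (privateDegree<degree v∈A) (degree≤maxDegree F v)
      sum-of-three : ∀ (f : Fin n → ℕ) → f a + f b + f c ≡ ∑[ v ∈ a ∷ b ∷ c ∷ [] ] f v
      sum-of-three f = trans (+-assoc (f a) (f b) (f c)) (cong (λ t → f a + (f b + t)) (sym (+-identityʳ (f c))))

    ∑weight≤ : ∑[ E ∈ F ] weight E A ≤ 2 * (2 * maxDegree F ⊔ 10)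
    ∑weight≤ =
      ≤2[2d⊔10] (subst (∑[ E ∈ F ] weight E A + 1 ≤_) (∑-distrib-+ (elements A) (degree F) privateDegree)
                       ∑weight+1≤∑degrees)
                (subst (λ k → ∑ (elements A) (degree F) ≤ maxDegree F * k) ∣A∣≡3
                       (∑-upper (elements A) (degree F) (maxDegree F) (λ {v} _ → degree≤maxDegree F v)))
                (∑privateDegree-bound (elements-unique A) (All.tabulate (∈-elements⁻ A)) ∣A∣≡3)
      where
      ∣A∣≡3 : length (elements A) ≡ 3
      ∣A∣≡3 = trans (length-elements A) (All.lookup threeF A∈F)

  size-bound : length F ≤ (2 * maxDegree F ⊔ 10) * length M
  size-bound = *-cancelˡ-≤ 2 (begin
    2 * length F                            ≤⟨ ∑-lower F (λ E → ∑[ A ∈ M ] weight E A) 2 2≤∑weight ⟩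
    ∑[ E ∈ F ] ∑[ A ∈ M ] weight E A        ≡⟨ ∑-comm F M weight ⟩
    ∑[ A ∈ M ] ∑[ E ∈ F ] weight E A        ≤⟨ ∑-upper M _ (2 * c) (λ A∈M → AtMatchingEdge.∑weight≤ A∈M) ⟩
    2 * c * length M                        ≡⟨ *-assoc 2 c (length M) ⟩
    2 * (c * length M)                      ∎)
    where
    open ≤-Reasoning
    c = 2 * maxDegree F ⊔ 10

theorem3 : ∀ (n : ℕ) (F : Family n) (d ν : ℕ) →
    Unique F → ThreeUniform F → Linear F →
    maxDegree F ≡ d → IsMatchingNumber F ν →
    length F ≤ (2 * d * ν) ⊔ (10 * ν)
theorem3 n F _ _ F! threeF linearF refl ((M , matchingM , refl) , maximumM) = begin
  length F                                           ≤⟨ MaximumMatching.size-bound F! threeF linearF matchingM maximumM ⟩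
  (2 * maxDegree F ⊔ 10) * length M                  ≡⟨ *-distribʳ-⊔ (length M) (2 * maxDegree F) 10 ⟩
  2 * maxDegree F * length M ⊔ 10 * length M         ∎
  where open ≤-Reasoning
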